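{- If some strongly connected component of the pair-digraph $G^+$ contains a circuit, then $G$ is not an interval $k$-graph (with respect to the given partition $V_1,\dots,V_k$).
   Context: $G$ is a graph with a given partition of $V(G)$ into independent sets (partite sets) $V_1,\dots,V_k$; $c(u)$ denotes the index of the partite set containing $u$. $G$ is an interval $k$-graph if there are real intervals $I_v$, $v\in V(G)$, such that for $u,v$ in different partite sets, $uv\in E(G)$ iff $I_u\cap I_v\neq\emptyset$. Let $\bar E=\{uv: u\in V_i, v\in V_j, i\neq j\}\setminus E(G)$. The pair-digraph $G^+$ has vertex set all ordered pairs $(u,v)$ with $u\ne v$ in $V(G)$, and arcs: (i) $(u,v)\to(u',v)$ whenever $c(u)=c(v)$, $uu'\in E(G)$, $vu'\notin E(G)$; (ii) $(u,v)\to(u',v)$ whenever $uu'\in E(G)$, $u'v\in\bar E$, and $u,v,u'$ lie in three different partite sets; (iii) $(u,v)\to(u,v')$ whenever $c(u)=c(v')$, $vv'\in E(G)$, $uv\notin E(G)$; (iv) $(u,v)\to(u,v')$ whenever $vv'\in E(G)$, $uv\in\bar E$, and $u,v,v'$ lie in three different partite sets. For $n\ge1$, a circuit in a set $D$ of pairs is a sequence $(x_0,x_1),(x_1,x_2),\dots,(x_{n-1},x_n),(x_n,x_0)$ of pairs all belonging to $D$. -}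

module Defs where

open import Level using (Level; _⊔_; suc)
open import Data.Nat using (ℕ) renaming (_≤_ to _≤ℕ_)
open import Data.Fin using (Fin)
open import Data.List using (List; []; _∷_; zip; _++_; [_]; length)
open import Data.List.Relation.Unary.All using (All)
open import Data.Product using (Σ; _×_; _,_; ∃)
open import Relation.Nullary using (¬_)
open import Relation.Binary.PropositionalEquality using (_≡_; _≢_)
open import Relation.Binary.Bundles using (TotalOrder)
open import Relation.Binary.Construct.Closure.ReflexiveTransitive using (Star)

record KPartiteGraph (n k : ℕ) : Set₁ where
  field
    E     : Fin n → Fin n → Set
    c     : Fin n → Fin k
    E-sym : ∀ {u v} → E u v → E v u
    indep : ∀ {u v} → c u ≡ c v → ¬ E u v

module _ {a ℓ₁ ℓ₂ : Level} (O : TotalOrder a ℓ₁ ℓ₂) where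
  open TotalOrder O renaming (Carrier to A)

  record Interval : Set (a ⊔ ℓ₂) where
    constructor [_,_]⟨_⟩
    field
      lo   : A
      hi   : A
      lo≤hi : lo ≤ hi

  open Interval

  -- [a,b] ∩ [c,d] ≠ ∅  iff  a ≤ d and c ≤ b
  Meets : Interval → Interval → Set ℓ₂
  Meets I J = (lo I ≤ hi J) × (lo J ≤ hi I)

  IsIntervalKGraph : ∀ {n k} → KPartiteGraph n k → Set (a ⊔ ℓ₂)
  IsIntervalKGraph {n} G =
    Σ (Fin n → Interval) λ I →
      ∀ u v → c u ≢ c v → (E u v → Meets (I u) (I v)) × (Meets (I u) (I v) → E u v)
    where open KPartiteGraph G

module _ {n k : ℕ} (G : KPartiteGraph n k) where
  open KPartiteGraph G

  Ebar : Fin n → Fin n → Set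
  Ebar u v = (c u ≢ c v) × ¬ E u v

  ThreeParts : Fin n → Fin n → Fin n → Set
  ThreeParts x y z = (c x ≢ c y) × (c y ≢ c z) × (c x ≢ c z)

  Pair : Set
  Pair = Fin n × Fin n

  -- vertices of G⁺ : ordered pairs of distinct vertices
  IsVertex : Pair → Set
  IsVertex (u , v) = u ≢ v

  data Arc : Pair → Pair → Set where
    arc-i   : ∀ {u v u'} → u ≢ v → c u ≡ c v → E u u' → ¬ E v u' → Arc (u , v) (u' , v)
    arc-ii  : ∀ {u v u'} → u ≢ v → E u u' → Ebar u' v → ThreeParts u v u' → Arc (u , v) (u' , v)
    arc-iii : ∀ {u v v'} → u ≢ v → c u ≡ c v' → E v v' → ¬ E u v → Arc (u , v) (u , v')
    arc-iv  : ∀ {u v v'} → u ≢ v → E v v' → Ebar u v → ThreeParts u v v' → Arc (u , v) (u , v')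

  Reach : Pair → Pair → Set
  Reach = Star Arc

  InSCCOf : Pair → Pair → Set
  InSCCOf r p = IsVertex r × IsVertex p × Reach r p × Reach p r

  -- pairs of the circuit (x₀,x₁),(x₁,x₂),…,(x_{m-1},x_m),(x_m,x₀)
  circuitPairs : Fin n → List (Fin n) → List Pair
  circuitPairs x₀ xs = zip (x₀ ∷ xs) (xs ++ [ x₀ ])

  SCCHasCircuit : Set
  SCCHasCircuit =
    Σ Pair λ r → Σ (Fin n) λ x₀ → Σ (List (Fin n)) λ xs →
      (1 ≤ℕ length xs) × All (InSCCOf r) (circuitPairs x₀ xs)

{-# OPTIONS --safe #-}
module Submission where

open import Defs
open import Level using (Level)
open import Data.Nat using (ℕ)
open import Relation.Nullary using (¬_)
open import Relation.Binary.Bundles using (TotalOrder)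

open import Data.Empty using (⊥; ⊥-elim)
open import Data.Fin using (Fin)
open import Data.List using ([]; _∷_; zip; _++_; [_])
open import Data.List.Relation.Unary.All as All using (All; []; _∷_)
open import Data.Product using (∃; _×_; _,_; proj₁; proj₂; uncurry)
open import Data.Sum using (_⊎_; inj₁; inj₂)
open import Function using (flip)
open import Relation.Binary.Core using (Rel)
open import Relation.Binary.Definitions using (Transitive)
open import Relation.Binary.PropositionalEquality using (_≢_; refl; sym; trans; cong)
open import Relation.Binary.Construct.Closure.ReflexiveTransitive using (Star; ε; _◅_; _◅◅_)
open import Relation.Unary using (Pred)

-- The right endpoints of an interval representation orient every pair (u , v)
-- as ascending (hi u ≤ hi v) or descending, and no arc of G⁺ leads from an
-- ascending pair to a descending one: the right end of the fixed interval would
-- fall inside the moved one, which must miss it.  Hence a strongly connected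
-- component is entirely ascending or entirely descending; a circuit inside it
-- then forces hi x₀ ≤ hi x₁ ≤ ⋯ ≤ hi x₀, so (x₀ , x₁) is both.  But a pair that
-- is both cannot lie on a closed walk: its successor on the walk is descending.

module _ {a} {A : Set a} where

  zip-path-trans : ∀ {ℓ} {R : Rel A ℓ} → Transitive R →
                   ∀ x zs y → All (uncurry R) (zip (x ∷ zs) (zs ++ [ y ])) → R x y
  zip-path-trans R-trans x []       y (xRy ∷ [])  = xRy
  zip-path-trans R-trans x (z ∷ zs) y (xRz ∷ zRy) = R-trans xRz (zip-path-trans R-trans z zs y zRy)

  zip-path-head : ∀ {ℓ} {P : Pred (A × A) ℓ} x zs y →
                  All P (zip (x ∷ zs) (zs ++ [ y ])) → ∃ λ w → P (x , w)
  zip-path-head x []       y (px ∷ []) = y , px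
  zip-path-head x (z ∷ zs) y (px ∷ _)  = z , px

module _ {v r} {V : Set v} {_⟶_ : Rel V r} where

  mutual-reach⇒cycle : ∀ {x y} → x ≢ y → Star _⟶_ x y → Star _⟶_ y x →
                       ∃ λ z → x ⟶ z × Star _⟶_ z x
  mutual-reach⇒cycle x≢y ε             _   = ⊥-elim (x≢y refl)
  mutual-reach⇒cycle _   (x⟶z ◅ z→y) y→x = _ , x⟶z , z→y ◅◅ y→x

  module Separated {p q} {P : Pred V p} {Q : Pred V q}
                   (P⊎Q : ∀ x → P x ⊎ Q x) (no-P⟶Q : ∀ {x y} → x ⟶ y → P x → Q y → ⊥) where

    Star-preserves-P : ∀ {x y} → Star _⟶_ x y → P x → P y
    Star-preserves-P ε px = px
    Star-preserves-P (x⟶z ◅ z→y) px with P⊎Q _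
    ... | inj₁ pz = Star-preserves-P z→y pz
    ... | inj₂ qz = ⊥-elim (no-P⟶Q x⟶z px qz)

    Star-reflects-Q : ∀ {x y} → Star _⟶_ x y → Q y → Q x
    Star-reflects-Q ε qy = qy
    Star-reflects-Q {x} (x⟶z ◅ z→y) qy with P⊎Q x
    ... | inj₁ px = ⊥-elim (no-P⟶Q x⟶z px (Star-reflects-Q z→y qy))
    ... | inj₂ qx = qx

    P∩Q-off-cycles : ∀ {x z} → x ⟶ z → Star _⟶_ z x → P x → Q x → ⊥
    P∩Q-off-cycles x⟶z z→x px qx = no-P⟶Q x⟶z px (Star-reflects-Q z→x qx)

module _ {a ℓ₁ ℓ₂} (O : TotalOrder a ℓ₁ ℓ₂) where
  open TotalOrder O using (_≤_) renaming (trans to ≤-trans)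
  open Interval

  Meets-sym : ∀ {J K} → Meets O J K → Meets O K J
  Meets-sym (loJ≤hiK , loK≤hiJ) = loK≤hiJ , loJ≤hiK

  hi∈⇒Meets : ∀ J K → lo K ≤ hi J → hi J ≤ hi K → Meets O K J
  hi∈⇒Meets J K loK≤hiJ hiJ≤hiK = loK≤hiJ , ≤-trans (lo≤hi J) hiJ≤hiK

module _ {n k} (G : KPartiteGraph n k) where
  open KPartiteGraph G

  data Shift : Pair G → Pair G → Set where
    shiftˡ : ∀ {u u′ v} → E u u′ → Ebar G u′ v → Shift (u , v) (u′ , v)
    shiftʳ : ∀ {u v v′} → E v v′ → Ebar G u v → Shift (u , v) (u , v′)

  Arc⇒Shift : ∀ {p q} → Arc G p q → Shift p q
  Arc⇒Shift (arc-i _ cu≡cv uu′ ¬vu′) =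
    shiftˡ uu′ ((λ cu′≡cv → indep (trans cu≡cv (sym cu′≡cv)) uu′) , λ u′v → ¬vu′ (E-sym u′v))
  Arc⇒Shift (arc-ii _ uu′ u′v̄ _) = shiftˡ uu′ u′v̄
  Arc⇒Shift (arc-iii _ cu≡cv′ vv′ ¬uv) =
    shiftʳ vv′ ((λ cu≡cv → indep (trans (sym cu≡cv) cu≡cv′) vv′) , ¬uv)
  Arc⇒Shift (arc-iv _ vv′ uv̄ _) = shiftʳ vv′ uv̄

  circuit-start-on-cycle : ∀ {r x₀ x₁ ys} → All (InSCCOf G r) (circuitPairs G x₀ (x₁ ∷ ys)) →
                           ∃ λ t → Arc G (x₀ , x₁) t × Reach G t (x₀ , x₁)
  circuit-start-on-cycle {x₀ = x₀} {x₁} {ys} ((_ , x₀≢x₁ , r→p₀ , p₀→r) ∷ rest)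
    with zip-path-head x₁ ys x₀ rest
  ... | _ , (_ , _ , r→p₁ , p₁→r) =
    mutual-reach⇒cycle (λ p₀≡p₁ → x₀≢x₁ (cong proj₁ p₀≡p₁)) (p₀→r ◅◅ r→p₁) (p₁→r ◅◅ r→p₀)

module Representation {n k} (G : KPartiteGraph n k) {a ℓ₁ ℓ₂} (O : TotalOrder a ℓ₁ ℓ₂)
                      (rep : IsIntervalKGraph O G) where
  open KPartiteGraph G
  open TotalOrder O using (_≤_; total) renaming (trans to ≤-trans)
  open Interval

  I : Fin n → Interval O
  I = proj₁ rep

  _≼_ : Rel (Fin n) ℓ₂
  u ≼ v = hi (I u) ≤ hi (I v)

  Ascending Descending : Pred (Pair G) ℓ₂
  Ascending  = uncurry _≼_
  Descending = uncurry (flip _≼_)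

  ascending⊎descending : ∀ p → Ascending p ⊎ Descending p
  ascending⊎descending (u , v) = total (hi (I u)) (hi (I v))

  edge⇒Meets : ∀ {u v} → E u v → Meets O (I u) (I v)
  edge⇒Meets {u} {v} uv = proj₁ (proj₂ rep u v (λ cu≡cv → indep cu≡cv uv)) uv

  non-edge⇒¬Meets : ∀ {u v} → Ebar G u v → ¬ Meets O (I u) (I v)
  non-edge⇒¬Meets {u} {v} (cu≢cv , ¬uv) meets = ¬uv (proj₂ (proj₂ rep u v cu≢cv) meets)

  no-ascending⟶descending : ∀ {p q} → Arc G p q → Ascending p → Descending q → ⊥
  no-ascending⟶descending arc = shift-case (Arc⇒Shift G arc)
    where
    shift-case : ∀ {p q} → Shift G p q → Ascending p → Descending q → ⊥
    shift-case (shiftˡ {u′ = u′} {v} uu′ u′v̄) u≼v v≼u′ =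
      non-edge⇒¬Meets u′v̄
        (hi∈⇒Meets O (I v) (I u′) (≤-trans (proj₂ (edge⇒Meets uu′)) u≼v) v≼u′)
    shift-case (shiftʳ {u} {v} vv′ uv̄) u≼v v′≼u =
      non-edge⇒¬Meets uv̄ (Meets-sym O {I v} {I u}
        (hi∈⇒Meets O (I u) (I v) (≤-trans (proj₁ (edge⇒Meets vv′)) v′≼u) u≼v))

  open Separated ascending⊎descending no-ascending⟶descending public
    renaming (Star-preserves-P to Reach-preserves-ascending;
              Star-reflects-Q to Reach-reflects-descending;
              P∩Q-off-cycles to tied-off-cycles)

  SCC-circuit-tied : ∀ {r x₀ x₁ ys} → All (InSCCOf G r) (circuitPairs G x₀ (x₁ ∷ ys)) →
                     Ascending (x₀ , x₁) × Descending (x₀ , x₁)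
  SCC-circuit-tied {r} {x₀} {x₁} {ys} (p₀∈C ∷ rest∈C) with ascending⊎descending r
  ... | inj₁ r↑ =
    ascending p₀∈C , zip-path-trans {R = _≼_} ≤-trans x₁ ys x₀ (All.map ascending rest∈C)
    where
    ascending : ∀ {p} → InSCCOf G r p → Ascending p
    ascending (_ , _ , r→p , _) = Reach-preserves-ascending r→p r↑
  ... | inj₂ r↓ =
    zip-path-trans {R = flip _≼_} (flip ≤-trans) x₁ ys x₀ (All.map descending rest∈C) , descending p₀∈C
    where
    descending : ∀ {p} → InSCCOf G r p → Descending p
    descending (_ , _ , _ , p→r) = Reach-reflects-descending p→r r↓

lemma3 : ∀ {n k : ℕ} (G : KPartiteGraph n k) → SCCHasCircuit G →
    ∀ {a ℓ₁ ℓ₂ : Level} (O : TotalOrder a ℓ₁ ℓ₂) → ¬ IsIntervalKGraph O G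
lemma3 G (_ , _ , [] , () , _) _ _
lemma3 G (_ , _ , _ ∷ _ , _ , circuit∈C) O rep
  with _ , p₀⟶t , t→p₀ ← circuit-start-on-cycle G circuit∈C
     | p₀↑ , p₀↓ ← Representation.SCC-circuit-tied G O rep circuit∈C
  = Representation.tied-off-cycles G O rep p₀⟶t t→p₀ p₀↑ p₀↓
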